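{- Let $G$ and $H$ be connected graphs of orders $n\geq 3$ and $m\geq 3$, respectively, and let $G+H$ be their join. Then $$\max\{\Delta(H)+n,\ \Delta(G)+m\}\leq \chi'_D(G+H)\leq \max\{\chi'_D(G),\chi'_D(H)\}+\chi'_D(K_{n,m}).$$
   Context: All graphs are finite and simple; $\Delta$ denotes maximum degree. The join $G+H$ has vertex set $V(G)\cup V(H)$ (disjoint) and edge set $E(G)\cup E(H)\cup\{uv: u\in V(G), v\in V(H)\}$. A proper edge labeling assigns labels to edges so that edges sharing an endpoint get different labels. An automorphism $f$ preserves an edge labeling $c$ if $c(\{f(u),f(v)\})=c(\{u,v\})$ for every edge. The distinguishing chromatic index $\chi'_D(G)$ is the least number $d$ such that $G$ has a proper edge labeling with $d$ labels preserved only by the identity automorphism. $K_{n,m}$ is the complete bipartite graph. -}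

module Defs where

open import Data.Nat using (ℕ; zero; suc; _+_; _<_; _≤_; _⊔_)
open import Data.Bool using (Bool; true; false)
open import Data.Fin using (Fin; splitAt)
open import Data.Fin.Permutation using (Permutation′; _⟨$⟩ʳ_)
open import Data.Sum using (_⊎_; inj₁; inj₂)
open import Data.Product using (Σ; _×_; _,_)
open import Data.List using (List; foldr; map; length; filter)
open import Data.List using (allFin)
open import Relation.Binary.PropositionalEquality using (_≡_; _≢_; refl)

record Graph (n : ℕ) : Set where
  field
    adj   : Fin n → Fin n → Bool
    sym   : ∀ u v → adj u v ≡ adj v u
    irrefl : ∀ u → adj u u ≡ false
open Graph public

Adj : ∀ {n} → Graph n → Fin n → Fin n → Set
Adj G u v = adj G u v ≡ true

degree : ∀ {n} → Graph n → Fin n → ℕ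
degree {n} G u = length (filter (λ v → Data.Bool._≟_ (adj G u v) true) (allFin n))
  where import Data.Bool

Δ : ∀ {n} → Graph n → ℕ
Δ {n} G = foldr _⊔_ 0 (map (degree G) (allFin n))

data Walk {n} (G : Graph n) : Fin n → Fin n → Set where
  stay : ∀ {u} → Walk G u u
  step : ∀ {u w v} → Adj G u w → Walk G w v → Walk G u v

Connected : ∀ {n} → Graph n → Set
Connected {n} G = (u v : Fin n) → Walk G u v

-- the join G + H on Fin (n + m): first n vertices are G, last m are H
joinAdj : ∀ {n m} → (Fin n → Fin n → Bool) → (Fin m → Fin m → Bool)
        → Fin n ⊎ Fin m → Fin n ⊎ Fin m → Bool
joinAdj a b (inj₁ x) (inj₁ y) = a x y
joinAdj a b (inj₂ x) (inj₂ y) = b x y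
joinAdj a b (inj₁ x) (inj₂ y) = true
joinAdj a b (inj₂ x) (inj₁ y) = true

joinAdj-sym : ∀ {n m} (G : Graph n) (H : Graph m) (s t : Fin n ⊎ Fin m)
            → joinAdj (adj G) (adj H) s t ≡ joinAdj (adj G) (adj H) t s
joinAdj-sym G H (inj₁ x) (inj₁ y) = sym G x y
joinAdj-sym G H (inj₂ x) (inj₂ y) = sym H x y
joinAdj-sym G H (inj₁ x) (inj₂ y) = refl
joinAdj-sym G H (inj₂ x) (inj₁ y) = refl

joinAdj-irr : ∀ {n m} (G : Graph n) (H : Graph m) (s : Fin n ⊎ Fin m)
            → joinAdj (adj G) (adj H) s s ≡ false
joinAdj-irr G H (inj₁ x) = irrefl G x
joinAdj-irr G H (inj₂ x) = irrefl H x

_⊕_ : ∀ {n m} → Graph n → Graph m → Graph (n + m)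
_⊕_ {n} {m} G H = record
  { adj    = λ x y → joinAdj (adj G) (adj H) (splitAt n x) (splitAt n y)
  ; sym    = λ x y → joinAdj-sym G H (splitAt n x) (splitAt n y)
  ; irrefl = λ x → joinAdj-irr G H (splitAt n x)
  }

edgeless : (n : ℕ) → Graph n
edgeless n = record { adj = λ _ _ → false ; sym = λ _ _ → refl ; irrefl = λ _ → refl }

K : (n m : ℕ) → Graph (n + m)
K n m = edgeless n ⊕ edgeless m

-- An edge labeling: c u v is the label of edge {u,v}; only values on edges matter.
Labeling : ℕ → Set
Labeling n = Fin n → Fin n → ℕ

IsProperLabeling : ∀ {n} → Graph n → ℕ → Labeling n → Set
IsProperLabeling G d c =
    (∀ u v → Adj G u v → c u v ≡ c v u)
  × (∀ u v → Adj G u v → c u v < d)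
  × (∀ u v w → Adj G u v → Adj G u w → v ≢ w → c u v ≢ c u w)

IsAutomorphism : ∀ {n} → Graph n → Permutation′ n → Set
IsAutomorphism G f = ∀ u v → adj G (f ⟨$⟩ʳ u) (f ⟨$⟩ʳ v) ≡ adj G u v

Preserves : ∀ {n} → Graph n → Permutation′ n → Labeling n → Set
Preserves G f c = ∀ u v → Adj G u v → c (f ⟨$⟩ʳ u) (f ⟨$⟩ʳ v) ≡ c u v

IsDistinguishing : ∀ {n} → Graph n → Labeling n → Set
IsDistinguishing G c =
  ∀ f → IsAutomorphism G f → Preserves G f c → ∀ u → f ⟨$⟩ʳ u ≡ u

HasDistinguishingEdgeLabeling : ∀ {n} → Graph n → ℕ → Set
HasDistinguishingEdgeLabeling {n} G d =
  Σ (Labeling n) λ c → IsProperLabeling G d c × IsDistinguishing G c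

IsDistChromIndex : ∀ {n} → Graph n → ℕ → Set
IsDistChromIndex G d =
  HasDistinguishingEdgeLabeling G d × (∀ d′ → HasDistinguishingEdgeLabeling G d′ → d ≤ d′)

module Submission where

-- Lower bound: a vertex u of G is adjacent in G + H to its deg_G(u) neighbours
-- in G and to all m vertices of H, and a proper labeling gives these edges
-- pairwise different labels (general lemma neighbours≤labels); maximising over
-- u, and symmetrically over H, gives max(Δ(H) + n, Δ(G) + m) (LowerBound).
--
-- Upper bound (UpperBound): with M = max(dG, dH), label edges inside G and H by
-- proper labelings of G and H (labels < M) and the crossing edges, a copy of
-- K_{n,m}, by M plus a distinguishing labeling of K_{n,m}.  This is proper with
-- M + dK labels.  A label-preserving automorphism keeps crossing edges (labels
-- ≥ M) crossing, so it is an automorphism of K_{n,m} preserving its labels,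
-- hence the identity.

open import Defs hiding (sym)
open import Data.Nat using (ℕ; _+_; _≤_; _<_; _⊔_; s≤s)
open import Data.Nat.Properties
  using (+-distribʳ-⊔; ⊔-lub; ≤-trans; m≤n+m; +-comm; <-≤-trans; m≤m⊔n; m≤n⊔m; m+n≮m; m≤m+n; +-monoʳ-<; +-cancelˡ-≡)
open import Data.Bool using (Bool; true; false; _xor_)
import Data.Bool as Bool
open import Data.Bool.Properties using (¬-not; xor-same; xor-inverseˡ)
open import Data.Fin using (Fin; zero; suc; splitAt; _↑ˡ_; _↑ʳ_; join; fromℕ<; _≟_)
open import Data.Fin.Properties
  using (splitAt-↑ˡ; splitAt-↑ʳ; join-splitAt; ↑ˡ-injective; ↑ʳ-injective; injective⇒≤; fromℕ<-injective)
open import Data.Fin.Permutation using (Permutation′; _⟨$⟩ʳ_)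
open import Data.Sum using (_⊎_; inj₁; inj₂)
open import Data.Product using (Σ; _×_; _,_; proj₁; proj₂)
open import Data.List using (List; []; _∷_; length; map; filter; foldr; allFin; _++_; lookup)
open import Data.List.Properties using (length-map; length-++; length-tabulate)
open import Data.List.Membership.Propositional using (_∈_)
open import Data.List.Membership.Propositional.Properties using (∈-lookup; ∈-map⁻; ∈-++⁻; ∈-filter⁻)
open import Data.List.Relation.Unary.All using (All; _∷_)
open import Data.List.Relation.Unary.AllPairs using (_∷_)
open import Data.List.Relation.Unary.Unique.Propositional using (Unique)
open import Data.List.Relation.Binary.Disjoint.Propositional using (Disjoint)
import Data.List.Relation.Unary.Unique.Propositional.Properties as Unique
open import Data.Empty using (⊥; ⊥-elim)
open import Relation.Nullary using (yes; no)
open import Relation.Binary.PropositionalEquality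

lookup-injective : ∀ {A : Set} {xs : List A} → Unique xs
                 → ∀ i j → lookup xs i ≡ lookup xs j → i ≡ j
lookup-injective (_ ∷ _)         zero    zero    _  = refl
lookup-injective (x≢ ∷ _)        zero    (suc j) eq = ⊥-elim (headDistinct x≢ j eq)
  where
  headDistinct : ∀ {A : Set} {x : A} {ys} → All (x ≢_) ys → ∀ j → x ≢ lookup ys j
  headDistinct (p ∷ _)  zero    = p
  headDistinct (_ ∷ ps) (suc j) = headDistinct ps j
lookup-injective u@(_ ∷ _)      (suc i) zero    eq =
  sym (lookup-injective u zero (suc i) (sym eq))
lookup-injective (_ ∷ u)         (suc i) (suc j) eq = cong suc (lookup-injective u i j eq)

-- If f x + k ≤ d for every x, then (max of f over xs) + k ≤ d; the empty
-- maximum is 0, which is why k ≤ d is also required.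
max+≤ : ∀ {A : Set} (f : A → ℕ) {k d} (xs : List A) → k ≤ d → (∀ x → f x + k ≤ d)
      → foldr _⊔_ 0 (map f xs) + k ≤ d
max+≤ f []       k≤d _     = k≤d
max+≤ f {k} {d} (x ∷ xs) k≤d bound =
  subst (_≤ d) (sym (+-distribʳ-⊔ k (f x) _)) (⊔-lub (bound x) (max+≤ f xs k≤d bound))

-- The edges from w to a duplicate-free list of its neighbours have pairwise
-- different labels, all below d; hence the list has at most d entries.
neighbours≤labels : ∀ {N} (X : Graph N) {d c} → IsProperLabeling X d c
                  → ∀ w (vs : List (Fin N)) → Unique vs → (∀ v → v ∈ vs → Adj X w v)
                  → length vs ≤ d
neighbours≤labels X {d} {c} (_ , bounded , distinct) w vs unique adjacent =
  injective⇒≤ {f = labelOf} labelOf-injective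
  where
  adjacentAt : ∀ i → Adj X w (lookup vs i)
  adjacentAt i = adjacent _ (∈-lookup i)

  labelOf : Fin (length vs) → Fin d
  labelOf i = fromℕ< (bounded w (lookup vs i) (adjacentAt i))

  labelOf-injective : ∀ {i j} → labelOf i ≡ labelOf j → i ≡ j
  labelOf-injective {i} {j} eq with lookup vs i ≟ lookup vs j
  ... | yes same = lookup-injective unique i j same
  ... | no differ = ⊥-elim (distinct w _ _ (adjacentAt i) (adjacentAt j) differ
                             (fromℕ<-injective _ _ _ _ eq))

module LowerBound {n m} (G : Graph n) (H : Graph m) where

  neighboursIn : ∀ {k} (X : Graph k) → Fin k → List (Fin k)
  neighboursIn {k} X u = filter (λ v → adj X u v Bool.≟ true) (allFin k)

  neighboursˡ : Fin n → List (Fin (n + m))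
  neighboursˡ u = map (_↑ˡ m) (neighboursIn G u) ++ map (n ↑ʳ_) (allFin m)

  neighboursʳ : Fin m → List (Fin (n + m))
  neighboursʳ u = map (_↑ˡ m) (allFin n) ++ map (n ↑ʳ_) (neighboursIn H u)

  left-right-disjoint : ∀ (xs : List (Fin n)) (ys : List (Fin m))
                      → Disjoint (map (_↑ˡ m) xs) (map (n ↑ʳ_) ys)
  left-right-disjoint xs ys (p , q) with ∈-map⁻ (_↑ˡ m) p | ∈-map⁻ (n ↑ʳ_) q
  ... | a , _ , refl | b , _ , eq with trans (sym (splitAt-↑ˡ n a m))
                                          (trans (cong (splitAt n) eq) (splitAt-↑ʳ n m b))
  ...   | ()

  neighboursˡ-unique : ∀ u → Unique (neighboursˡ u)
  neighboursˡ-unique u =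
    Unique.++⁺ (Unique.map⁺ (↑ˡ-injective m _ _) (Unique.filter⁺ _ (Unique.allFin⁺ n)))
               (Unique.map⁺ (↑ʳ-injective n _ _) (Unique.allFin⁺ m)) (left-right-disjoint _ _)

  neighboursʳ-unique : ∀ u → Unique (neighboursʳ u)
  neighboursʳ-unique u =
    Unique.++⁺ (Unique.map⁺ (↑ˡ-injective m _ _) (Unique.allFin⁺ n))
               (Unique.map⁺ (↑ʳ-injective n _ _) (Unique.filter⁺ _ (Unique.allFin⁺ m)))
               (left-right-disjoint _ _)

  neighboursˡ-adjacent : ∀ u v → v ∈ neighboursˡ u → Adj (G ⊕ H) (u ↑ˡ m) v
  neighboursˡ-adjacent u v p with ∈-++⁻ (map (_↑ˡ m) (neighboursIn G u)) p
  ... | inj₁ q with ∈-map⁻ (_↑ˡ m) q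
  ...   | a , a∈ , refl rewrite splitAt-↑ˡ n u m | splitAt-↑ˡ n a m =
          proj₂ (∈-filter⁻ (λ v → adj G u v Bool.≟ true) {xs = allFin n} a∈)
  neighboursˡ-adjacent u v p | inj₂ q with ∈-map⁻ (n ↑ʳ_) q
  ...   | b , _ , refl rewrite splitAt-↑ˡ n u m | splitAt-↑ʳ n m b = refl

  neighboursʳ-adjacent : ∀ u v → v ∈ neighboursʳ u → Adj (G ⊕ H) (n ↑ʳ u) v
  neighboursʳ-adjacent u v p with ∈-++⁻ (map (_↑ˡ m) (allFin n)) p
  ... | inj₁ q with ∈-map⁻ (_↑ˡ m) q
  ...   | a , _ , refl rewrite splitAt-↑ʳ n m u | splitAt-↑ˡ n a m = refl
  neighboursʳ-adjacent u v p | inj₂ q with ∈-map⁻ (n ↑ʳ_) q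
  ...   | b , b∈ , refl rewrite splitAt-↑ʳ n m u | splitAt-↑ʳ n m b =
          proj₂ (∈-filter⁻ (λ v → adj H u v Bool.≟ true) {xs = allFin m} b∈)

  length-allFin : ∀ k → length (allFin k) ≡ k
  length-allFin k = length-tabulate (λ i → i)

  length-neighboursˡ : ∀ u → length (neighboursˡ u) ≡ degree G u + m
  length-neighboursˡ u = begin
    length (neighboursˡ u)
      ≡⟨ length-++ (map (_↑ˡ m) (neighboursIn G u)) ⟩
    length (map (_↑ˡ m) (neighboursIn G u)) + length (map (n ↑ʳ_) (allFin m))
      ≡⟨ cong₂ _+_ (length-map (_↑ˡ m) (neighboursIn G u))
                   (trans (length-map (n ↑ʳ_) (allFin m)) (length-allFin m)) ⟩
    degree G u + m ∎
    where open ≡-Reasoning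

  length-neighboursʳ : ∀ u → length (neighboursʳ u) ≡ degree H u + n
  length-neighboursʳ u = begin
    length (neighboursʳ u)
      ≡⟨ length-++ (map (_↑ˡ m) (allFin n)) ⟩
    length (map (_↑ˡ m) (allFin n)) + length (map (n ↑ʳ_) (neighboursIn H u))
      ≡⟨ cong₂ _+_ (trans (length-map (_↑ˡ m) (allFin n)) (length-allFin n))
                   (length-map (n ↑ʳ_) (neighboursIn H u)) ⟩
    n + degree H u
      ≡⟨ +-comm n _ ⟩
    degree H u + n ∎
    where open ≡-Reasoning

  -- Any proper labeling of G ⊕ H uses at least max(Δ(H) + n, Δ(G) + m) labels;
  -- the vertices a and b only witness that G and H are nonempty.
  lowerBound : ∀ {d c} → IsProperLabeling (G ⊕ H) d c → Fin n → Fin m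
             → (Δ H + n) ⊔ (Δ G + m) ≤ d
  lowerBound {d} proper a b =
    ⊔-lub (max+≤ (degree H) (allFin m) (≤-trans (m≤n+m n _) (boundʳ b)) boundʳ)
          (max+≤ (degree G) (allFin n) (≤-trans (m≤n+m m _) (boundˡ a)) boundˡ)
    where
    boundˡ : ∀ u → degree G u + m ≤ d
    boundˡ u = subst (_≤ d) (length-neighboursˡ u)
      (neighbours≤labels (G ⊕ H) proper (u ↑ˡ m) _ (neighboursˡ-unique u) (neighboursˡ-adjacent u))
    boundʳ : ∀ u → degree H u + n ≤ d
    boundʳ u = subst (_≤ d) (length-neighboursʳ u)
      (neighbours≤labels (G ⊕ H) proper (n ↑ʳ u) _ (neighboursʳ-unique u) (neighboursʳ-adjacent u))

xor-≢ : ∀ {a b} → a ≢ b → a xor b ≡ true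
xor-≢ {a} {b} a≢b = trans (cong (_xor b) (¬-not a≢b)) (xor-inverseˡ b)

xor-≡ : ∀ {a b} → a ≡ b → a xor b ≡ false
xor-≡ {a} refl = xor-same a

true⇒xor-≢ : ∀ {a b} → a xor b ≡ true → a ≢ b
true⇒xor-≢ {a} eq refl with () ← trans (sym eq) (xor-same a)

≢-same-≡ : ∀ {a b c : Bool} → a ≢ c → b ≢ c → a ≡ b
≢-same-≡ a≢c b≢c = trans (¬-not a≢c) (sym (¬-not b≢c))

module UpperBound {n m} (G : Graph n) (H : Graph m)
  {dG dH dK : ℕ} {cG : Labeling n} {cH : Labeling m} {cK : Labeling (n + m)}
  (properG : IsProperLabeling G dG cG) (properH : IsProperLabeling H dH cH)
  (properK : IsProperLabeling (K n m) dK cK) (distinguishK : IsDistinguishing (K n m) cK) where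

  -- the labels M, M+1, … are reserved for the crossing edges
  M : ℕ
  M = dG ⊔ dH

  combine : Fin n ⊎ Fin m → Fin n ⊎ Fin m → Fin (n + m) → Fin (n + m) → ℕ
  combine (inj₁ a) (inj₁ b) x y = cG a b
  combine (inj₂ a) (inj₂ b) x y = cH a b
  combine (inj₁ a) (inj₂ b) x y = M + cK x y
  combine (inj₂ a) (inj₁ b) x y = M + cK x y

  label : Labeling (n + m)
  label x y = combine (splitAt n x) (splitAt n y) x y

  side : Fin (n + m) → Bool
  side x with splitAt n x
  ... | inj₁ _ = true
  ... | inj₂ _ = false

  Crossing : Fin (n + m) → Fin (n + m) → Set
  Crossing x y = side x ≢ side y

  adjK-xor : ∀ x y → adj (K n m) x y ≡ side x xor side y
  adjK-xor x y with splitAt n x | splitAt n y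
  ... | inj₁ _ | inj₁ _ = refl
  ... | inj₁ _ | inj₂ _ = refl
  ... | inj₂ _ | inj₁ _ = refl
  ... | inj₂ _ | inj₂ _ = refl

  crossing⇒adjK : ∀ {x y} → Crossing x y → Adj (K n m) x y
  crossing⇒adjK {x} {y} c = trans (adjK-xor x y) (xor-≢ c)

  adjK⇒crossing : ∀ {x y} → Adj (K n m) x y → Crossing x y
  adjK⇒crossing {x} {y} e = true⇒xor-≢ (trans (sym (adjK-xor x y)) e)

  crossing⇒adj : ∀ x y → Crossing x y → Adj (G ⊕ H) x y
  crossing⇒adj x y c with splitAt n x | splitAt n y
  ... | inj₁ _ | inj₁ _ = ⊥-elim (c refl)
  ... | inj₁ _ | inj₂ _ = refl
  ... | inj₂ _ | inj₁ _ = refl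
  ... | inj₂ _ | inj₂ _ = ⊥-elim (c refl)

  crossing-label : ∀ x y → Crossing x y → label x y ≡ M + cK x y
  crossing-label x y c with splitAt n x | splitAt n y
  ... | inj₁ _ | inj₁ _ = ⊥-elim (c refl)
  ... | inj₁ _ | inj₂ _ = refl
  ... | inj₂ _ | inj₁ _ = refl
  ... | inj₂ _ | inj₂ _ = ⊥-elim (c refl)

  sameSide-label< : ∀ x y → side x ≡ side y → Adj (G ⊕ H) x y → label x y < M
  sameSide-label< x y s A with splitAt n x | splitAt n y
  ... | inj₁ a | inj₁ b = <-≤-trans (proj₁ (proj₂ properG) a b A) (m≤m⊔n dG dH)
  ... | inj₂ a | inj₂ b = <-≤-trans (proj₁ (proj₂ properH) a b A) (m≤n⊔m dG dH)
  ... | inj₁ _ | inj₂ _ with () ← s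
  ... | inj₂ _ | inj₁ _ with () ← s

  sameSide-symmetric : ∀ x y → side x ≡ side y → Adj (G ⊕ H) x y → label x y ≡ label y x
  sameSide-symmetric x y s A with splitAt n x | splitAt n y
  ... | inj₁ a | inj₁ b = proj₁ properG a b A
  ... | inj₂ a | inj₂ b = proj₁ properH a b A
  ... | inj₁ _ | inj₂ _ with () ← s
  ... | inj₂ _ | inj₁ _ with () ← s

  splitAt-injective : ∀ {v w} → splitAt n v ≡ splitAt n w → v ≡ w
  splitAt-injective {v} {w} e =
    trans (sym (join-splitAt n m v)) (trans (cong (join n m) e) (join-splitAt n m w))

  sameSide-distinct : ∀ u v w → side u ≡ side v → side u ≡ side w
                    → Adj (G ⊕ H) u v → Adj (G ⊕ H) u w → v ≢ w → label u v ≢ label u w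
  sameSide-distinct u v w s₁ s₂ A₁ A₂ v≢w
    with splitAt n u | splitAt n v in ev | splitAt n w in ew
  ... | inj₁ a | inj₁ b | inj₁ c = proj₂ (proj₂ properG) a b c A₁ A₂
        (λ b≡c → v≢w (splitAt-injective (trans ev (trans (cong inj₁ b≡c) (sym ew)))))
  ... | inj₂ a | inj₂ b | inj₂ c = proj₂ (proj₂ properH) a b c A₁ A₂
        (λ b≡c → v≢w (splitAt-injective (trans ev (trans (cong inj₂ b≡c) (sym ew)))))
  ... | inj₁ _ | inj₂ _ | _      with () ← s₁
  ... | inj₁ _ | inj₁ _ | inj₂ _ with () ← s₂
  ... | inj₂ _ | inj₁ _ | _      with () ← s₁
  ... | inj₂ _ | inj₂ _ | inj₁ _ with () ← s₂

  crossing-label≮M : ∀ x y → Crossing x y → label x y < M → ⊥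
  crossing-label≮M x y c lt = m+n≮m M (cK x y) (subst (_< M) (crossing-label x y c) lt)

  proper : IsProperLabeling (G ⊕ H) (M + dK) label
  proper = symmetric , bounded , distinct
    where
    symmetric : ∀ x y → Adj (G ⊕ H) x y → label x y ≡ label y x
    symmetric x y A with side x Bool.≟ side y
    ... | yes s = sameSide-symmetric x y s A
    ... | no c = begin
      label x y   ≡⟨ crossing-label x y c ⟩
      M + cK x y  ≡⟨ cong (M +_) (proj₁ properK x y (crossing⇒adjK c)) ⟩
      M + cK y x  ≡⟨ sym (crossing-label y x (λ e → c (sym e))) ⟩
      label y x   ∎
      where open ≡-Reasoning

    bounded : ∀ x y → Adj (G ⊕ H) x y → label x y < M + dK
    bounded x y A with side x Bool.≟ side y
    ... | yes s = <-≤-trans (sameSide-label< x y s A) (m≤m+n M dK)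
    ... | no c = subst (_< M + dK) (sym (crossing-label x y c))
                   (+-monoʳ-< M (proj₁ (proj₂ properK) x y (crossing⇒adjK c)))

    distinct : ∀ u v w → Adj (G ⊕ H) u v → Adj (G ⊕ H) u w → v ≢ w → label u v ≢ label u w
    distinct u v w A₁ A₂ v≢w eq with side u Bool.≟ side v | side u Bool.≟ side w
    ... | yes s₁ | yes s₂ = sameSide-distinct u v w s₁ s₂ A₁ A₂ v≢w eq
    ... | no c₁  | no c₂  = proj₂ (proj₂ properK) u v w (crossing⇒adjK c₁) (crossing⇒adjK c₂) v≢w
        (+-cancelˡ-≡ M _ _ (trans (sym (crossing-label u v c₁)) (trans eq (crossing-label u w c₂))))
    ... | no c₁  | yes s₂ = crossing-label≮M u v c₁ (subst (_< M) (sym eq) (sameSide-label< u w s₂ A₂))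
    ... | yes s₁ | no c₂  = crossing-label≮M u w c₂ (subst (_< M) eq (sameSide-label< u v s₁ A₁))

  module Distinguishing (a : Fin n) (b : Fin m) where

    vertexAvoiding : ∀ s → Σ (Fin (n + m)) λ w → side w ≢ s
    vertexAvoiding true  = n ↑ʳ b , λ e → true≢side-b (sym e)
      where
      true≢side-b : true ≢ side (n ↑ʳ b)
      true≢side-b e rewrite splitAt-↑ʳ n m b with () ← e
    vertexAvoiding false = a ↑ˡ m , side-a≢false
      where
      side-a≢false : side (a ↑ˡ m) ≢ false
      side-a≢false e rewrite splitAt-↑ˡ n a m with () ← e

    module _ (f : Permutation′ (n + m)) (auto : IsAutomorphism (G ⊕ H) f)
             (preserves : Preserves (G ⊕ H) f label) where

      -- crossing edges are the edges with labels ≥ M, so f keeps them crossing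
      keepsCrossing : ∀ x y → Crossing x y → Crossing (f ⟨$⟩ʳ x) (f ⟨$⟩ʳ y)
      keepsCrossing x y c s = crossing-label≮M x y c
        (subst (_< M) (preserves x y (crossing⇒adj x y c))
          (sameSide-label< _ _ s (trans (auto x y) (crossing⇒adj x y c))))

      -- two vertices on one side both cross to a vertex w on the other side;
      -- their images both cross to f w, so they again lie on one side
      keepsSameSide : ∀ x y → side x ≡ side y → side (f ⟨$⟩ʳ x) ≡ side (f ⟨$⟩ʳ y)
      keepsSameSide x y s with vertexAvoiding (side x)
      ... | w , w-avoids = ≢-same-≡ (keepsCrossing x w (λ e → w-avoids (sym e)))
                                    (keepsCrossing y w (λ e → w-avoids (trans (sym e) (sym s))))

      automorphismK : IsAutomorphism (K n m) f
      automorphismK x y with side x Bool.≟ side y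
      ... | yes s = trans (adjK-xor _ _) (trans (xor-≡ (keepsSameSide x y s))
                      (sym (trans (adjK-xor x y) (xor-≡ s))))
      ... | no c  = trans (adjK-xor _ _) (trans (xor-≢ (keepsCrossing x y c))
                      (sym (trans (adjK-xor x y) (xor-≢ c))))

      preservesK : Preserves (K n m) f cK
      preservesK x y adjacent = +-cancelˡ-≡ M _ _ (begin
        M + cK (f ⟨$⟩ʳ x) (f ⟨$⟩ʳ y) ≡⟨ sym (crossing-label _ _ (keepsCrossing x y c)) ⟩
        label (f ⟨$⟩ʳ x) (f ⟨$⟩ʳ y)  ≡⟨ preserves x y (crossing⇒adj x y c) ⟩
        label x y                    ≡⟨ crossing-label x y c ⟩
        M + cK x y                   ∎)
        where
        open ≡-Reasoning
        c : Crossing x y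
        c = adjK⇒crossing adjacent

    distinguishing : IsDistinguishing (G ⊕ H) label
    distinguishing f auto preserves =
      distinguishK f (automorphismK f auto preserves) (preservesK f auto preserves)

  -- the vertices a and b only witness that G and H are nonempty
  upperBound : Fin n → Fin m → HasDistinguishingEdgeLabeling (G ⊕ H) (M + dK)
  upperBound a b = label , proper , Distinguishing.distinguishing a b

mainTheorem4 : ∀ {n m} (G : Graph n) (H : Graph m)
    → 3 ≤ n → 3 ≤ m → Connected G → Connected H
    → ∀ {dGH dG dH dK}
    → IsDistChromIndex (G ⊕ H) dGH → IsDistChromIndex G dG
    → IsDistChromIndex H dH → IsDistChromIndex (K n m) dK
    → ((Δ H + n) ⊔ (Δ G + m) ≤ dGH) × (dGH ≤ (dG ⊔ dH) + dK)
mainTheorem4 G H (s≤s _) (s≤s _) _ _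
  ((_ , properGH , _) , minimalGH) ((_ , properG , _) , _)
  ((_ , properH , _) , _) ((_ , properK , distinguishK) , _) =
    LowerBound.lowerBound G H properGH zero zero ,
    minimalGH _ (UpperBound.upperBound G H properG properH properK distinguishK zero zero)
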